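{- Let $n\ge 3$, $k\ge1$ with $n=2k+1$, and let $ADF_n$ be the digraph on vertex set $\{1,2,\ldots,n\}$ with arcs: $(t,t+1)$ for $2\le t\le n-1$; $(1,2i)$ for $i=1,\ldots,k$; and $(2i+1,1)$ for $i=1,\ldots,k$. Then $$\Psi_{ADF_{2k+1}}(x)=x^{2k+1}-\sum_{i=1}^{k} i\,x^{2(i-1)}.$$
   Context: The characteristic polynomial $\Psi_X(x)$ of a digraph $X$ is $\det(xI-A)$, where $A$ is the adjacency matrix of $X$ (the $(i,j)$ entry is the number of arcs from $i$ to $j$). -}

module Defs where

open import Level using (Level)
open import Data.Nat as ℕ using (ℕ; zero; suc)
open import Data.Nat.Properties using () renaming (_≟_ to _≟ℕ_)
open import Data.Fin using (Fin; zero; suc; toℕ; punchIn)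
open import Data.List using (List; []; _∷_; map; length; filter; _++_; upTo; applyUpTo)
open import Data.Product using (_×_; _,_)
open import Data.Product.Properties using (≡-dec)
open import Relation.Binary.PropositionalEquality using (_≡_)
import Relation.Nullary
import Algebra.Bundles
open Algebra.Bundles using (CommutativeRing)
import Algebra.Definitions.RawSemiring as RS

-- A digraph on vertex set {1,…,n}: an arc list (multigraph allowed), vertices as 1-based ℕ labels.
record Digraph : Set where
  field
    order : ℕ
    arcs  : List (ℕ × ℕ)
open Digraph public

arcCount : List (ℕ × ℕ) → ℕ → ℕ → ℕ
arcCount as i j = length (filter (λ a → ≡-dec _≟ℕ_ _≟ℕ_ a (i , j)) as)

ADF : ℕ → Digraph
ADF k = record
  { order = n
  ; arcs  = applyUpTo (λ m → (m ℕ.+ 2 , m ℕ.+ 3)) (n ℕ.∸ 2)   -- t = m+2, m = 0..n-3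
         ++ applyUpTo (λ m → (1 , 2 ℕ.* (m ℕ.+ 1))) k         -- i = m+1
         ++ applyUpTo (λ m → (2 ℕ.* (m ℕ.+ 1) ℕ.+ 1 , 1)) k
  }
  where n = 2 ℕ.* k ℕ.+ 1

module _ {c ℓ : Level} (R : CommutativeRing c ℓ) where
  open CommutativeRing R using (Carrier; _+_; _*_; -_; _-_; 0#; 1#; semiring)
  open RS (Algebra.Bundles.Semiring.rawSemiring semiring) public using (_^_) renaming (_×_ to _·ℕ_)

  ΣFin : (n : ℕ) → (Fin n → Carrier) → Carrier
  ΣFin zero    f = 0#
  ΣFin (suc n) f = f zero + ΣFin n (λ j → f (suc j))

  sgn : ℕ → Carrier
  sgn zero    = 1#
  sgn (suc m) = - sgn m

  det : (n : ℕ) → (Fin n → Fin n → Carrier) → Carrier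
  det zero    M = 1#
  det (suc n) M = ΣFin (suc n) λ j →
    sgn (toℕ j) * (M zero j * det n (λ r s → M (suc r) (punchIn j s)))

  adjacency : (X : Digraph) → Fin (order X) → Fin (order X) → Carrier
  adjacency X i j = arcCount (arcs X) (suc (toℕ i)) (suc (toℕ j)) ·ℕ 1#

  identity : (n : ℕ) → Fin n → Fin n → Carrier
  identity n i j with toℕ i ≟ℕ toℕ j
  ... | Relation.Nullary.yes _ = 1#
  ... | Relation.Nullary.no  _ = 0#

  charPoly : (X : Digraph) → Carrier → Carrier
  charPoly X x = det (order X) (λ i j → x * identity (order X) i j - adjacency X i j)

  rhsSum : ℕ → Carrier → Carrier
  rhsSum zero    x = 0#
  rhsSum (suc k) x = rhsSum k x + (suc k ·ℕ (x ^ (2 ℕ.* k)))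

module Submission where

-- Index the vertices 1, …, 2k+1 of ADF_{2k+1} by matrix positions
-- 0, …, 2k.  Then xI − A is a "bordered bidiagonal" matrix: its lower-right
-- 2k × 2k block is xI − N (x on the diagonal, −1 just above it, coming from
-- the path 2 → 3 → … → 2k+1), its first row is (x, −1, 0, −1, 0, …) (arcs
-- 1 → 2i) and its first column below the corner is (−1 at odd vertices, 0
-- at even ones) (arcs 2i+1 → 1).
--
-- BorderedBidiagonal (general): for any first row f and column c, the
--   first-row minors are x^m (column 0), a weighted column sum (column 1),
--   and −x times a smaller minor of the same kind (columns ≥ 2).
-- ADFDeterminant: both border vectors of ADF are 2-periodic, so the
--   Laplace tail for 2k+2 equals the tail for 2k times x² plus
--   −(1 + x² + … + x^(2k)); induction on k yields −∑ i x^(2(i−1)).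

open import Defs hiding (_^_)
open import Level using (Level)
import Data.Nat as ℕ
open ℕ using (ℕ; zero; suc; _<_; z≤n; s≤s)
open import Data.Nat.Properties using (_≟_; suc-injective; *-suc)
open import Data.Bool using (Bool; true; false)
open import Data.Fin using (Fin; toℕ; punchIn) renaming (zero to fzero; suc to fsuc)
open import Data.Fin.Properties using (toℕ<n)
open import Data.Product using (∃; _×_; _,_)
open import Relation.Nullary using (yes; no; contradiction)
open import Relation.Binary.PropositionalEquality as ≡ using (_≡_; _≢_)
open import Algebra.Bundles using (CommutativeRing)

module Determinant {c ℓ : Level} (R : CommutativeRing c ℓ) where
  open CommutativeRing R hiding (zero) renaming (Carrier to C)
  open import Relation.Binary.Reasoning.Setoid setoid

  ∑ : ℕ → (ℕ → C) → C
  ∑ zero    f = 0#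
  ∑ (suc n) f = f 0 + ∑ n (λ j → f (suc j))

  ∑-cong : ∀ n {f g : ℕ → C} → (∀ j → j < n → f j ≈ g j) → ∑ n f ≈ ∑ n g
  ∑-cong zero    f≈g = refl
  ∑-cong (suc n) f≈g = +-cong (f≈g 0 (s≤s z≤n)) (∑-cong n (λ j j<n → f≈g (suc j) (s≤s j<n)))

  ∑-zero : ∀ n {f : ℕ → C} → (∀ j → j < n → f j ≈ 0#) → ∑ n f ≈ 0#
  ∑-zero n {f} f≈0 = trans (∑-cong n f≈0) (∑-of-zeros n)
    where
    ∑-of-zeros : ∀ n → ∑ n (λ _ → 0#) ≈ 0#
    ∑-of-zeros zero    = refl
    ∑-of-zeros (suc n) = trans (+-identityˡ _) (∑-of-zeros n)

  *-distribˡ-∑ : ∀ n a (f : ℕ → C) → a * ∑ n f ≈ ∑ n (λ j → a * f j)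
  *-distribˡ-∑ zero    a f = zeroʳ a
  *-distribˡ-∑ (suc n) a f = trans (distribˡ a _ _) (+-cong refl (*-distribˡ-∑ n a _))

  ΣFin-toℕ : ∀ n (g : ℕ → C) → ΣFin R n (λ j → g (toℕ j)) ≡ ∑ n g
  ΣFin-toℕ zero    g = ≡.refl
  ΣFin-toℕ (suc n) g = ≡.cong (g 0 +_) (ΣFin-toℕ n (λ j → g (suc j)))

  ΣFin-cong : ∀ n {f g : Fin n → C} → (∀ j → f j ≈ g j) → ΣFin R n f ≈ ΣFin R n g
  ΣFin-cong zero    f≈g = refl
  ΣFin-cong (suc n) f≈g = +-cong (f≈g fzero) (ΣFin-cong n (λ j → f≈g (fsuc j)))

  det-cong : ∀ n {M N : Fin n → Fin n → C} → (∀ i j → M i j ≈ N i j) → det R n M ≈ det R n N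
  det-cong zero    M≈N = refl
  det-cong (suc n) {M} {N} M≈N =
    ΣFin-cong (suc n) {expansion M} {expansion N} λ j →
      *-cong refl (*-cong (M≈N fzero j) (det-cong n (λ r s → M≈N (fsuc r) (punchIn j s))))
    where
    expansion : (Fin (suc n) → Fin (suc n) → C) → Fin (suc n) → C
    expansion A j = sgn R (toℕ j) * (A fzero j * det R n (λ r s → A (fsuc r) (punchIn j s)))

  Matrix : Set c
  Matrix = ℕ → ℕ → C

  detℕ : ℕ → Matrix → C
  detℕ n M = det R n (λ i j → M (toℕ i) (toℕ j))

  detℕ-cong : ∀ n {M N : Matrix} → (∀ i j → i < n → j < n → M i j ≈ N i j) → detℕ n M ≈ detℕ n N
  detℕ-cong n M≈N = det-cong n λ i j → M≈N (toℕ i) (toℕ j) (toℕ<n i) (toℕ<n j)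

  punchInℕ : ℕ → ℕ → ℕ
  punchInℕ zero    s       = suc s
  punchInℕ (suc j) zero    = zero
  punchInℕ (suc j) (suc s) = suc (punchInℕ j s)

  toℕ-punchIn : ∀ {n} (j : Fin (suc n)) (s : Fin n) → toℕ (punchIn j s) ≡ punchInℕ (toℕ j) (toℕ s)
  toℕ-punchIn fzero    s        = ≡.refl
  toℕ-punchIn (fsuc j) fzero    = ≡.refl
  toℕ-punchIn (fsuc j) (fsuc s) = ≡.cong suc (toℕ-punchIn j s)

  punchInℕ-onto : ∀ n j c → j < suc n → c < suc n → j ≢ c →
                  ∃ λ c′ → c′ < n × punchInℕ j c′ ≡ c
  punchInℕ-onto n       zero    zero    _         _         j≢c = contradiction ≡.refl j≢c
  punchInℕ-onto n       zero    (suc c) _         (s≤s c<n) _   = c , c<n , ≡.refl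
  punchInℕ-onto zero    (suc j) _       (s≤s ())  _         _
  punchInℕ-onto (suc n) (suc j) zero    _         _         _   = zero , s≤s z≤n , ≡.refl
  punchInℕ-onto (suc n) (suc j) (suc c) (s≤s j<n) (s≤s c<n) j≢c
    with punchInℕ-onto n j c j<n c<n (λ j≡c → j≢c (≡.cong suc j≡c))
  ... | c′ , c′<n , hit = suc c′ , s≤s c′<n , ≡.cong suc hit

  minor : ℕ → Matrix → Matrix
  minor j M r s = M (suc r) (punchInℕ j s)

  cofactorTerm : ℕ → Matrix → ℕ → C
  cofactorTerm n M j = sgn R j * (M 0 j * detℕ n (minor j M))

  laplace : ∀ n M → detℕ (suc n) M ≈ ∑ (suc n) (cofactorTerm n M)
  laplace n M = begin
    detℕ (suc n) M
      ≈⟨ ΣFin-cong (suc n) {g = λ j → cofactorTerm n M (toℕ j)} (λ j →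
           *-cong refl (*-cong refl (det-cong n λ r s → reflexive (≡.cong (M (suc (toℕ r))) (toℕ-punchIn j s))))) ⟩
    ΣFin R (suc n) (λ j → cofactorTerm n M (toℕ j))
      ≡⟨ ΣFin-toℕ (suc n) (cofactorTerm n M) ⟩
    ∑ (suc n) (cofactorTerm n M) ∎

  cofactor-zeroEntry : ∀ n M j → M 0 j ≈ 0# → cofactorTerm n M j ≈ 0#
  cofactor-zeroEntry n M j entry≈0 = trans (*-cong refl (trans (*-cong entry≈0 refl) (zeroˡ _))) (zeroʳ _)

  cofactor-zeroMinor : ∀ n M j → detℕ n (minor j M) ≈ 0# → cofactorTerm n M j ≈ 0#
  cofactor-zeroMinor n M j minor≈0 = trans (*-cong refl (trans (*-cong refl minor≈0) (zeroʳ _))) (zeroʳ _)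

  det-zeroColumn : ∀ n (M : Matrix) c → c < n → (∀ r → M r c ≈ 0#) → detℕ n M ≈ 0#
  det-zeroColumn (suc n) M c c<n M-c≈0 = trans (laplace n M) (∑-zero (suc n) vanishing)
    where
    vanishing : ∀ j → j < suc n → cofactorTerm n M j ≈ 0#
    vanishing j j<n with j ≟ c
    ... | yes ≡.refl = cofactor-zeroEntry n M j (M-c≈0 0)
    ... | no j≢c with punchInℕ-onto n j c j<n c<n j≢c
    ... | c′ , c′<n , hit = cofactor-zeroMinor n M j (det-zeroColumn n (minor j M) c′ c′<n
            (λ r → trans (reflexive (≡.cong (M (suc r)) hit)) (M-c≈0 (suc r))))

module BorderedBidiagonal {c ℓ : Level} (R : CommutativeRing c ℓ) (x : CommutativeRing.Carrier R) where
  open CommutativeRing R hiding (zero) renaming (Carrier to C)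
  open import Algebra.Properties.Ring ring using (-1*x≈-x; -‿distribˡ-*; -‿distribʳ-*; -‿involutive; -0#≈0#)
  open import Algebra.Properties.Semiring.Exp semiring using (_^_)
  open import Relation.Nullary using (does)
  open import Relation.Binary.Reasoning.Setoid setoid
  open Determinant R

  bidiag : Matrix
  bidiag zero    zero          = x
  bidiag zero    (suc zero)    = - 1#
  bidiag zero    (suc (suc t)) = 0#
  bidiag (suc r) zero          = 0#
  bidiag (suc r) (suc t)       = bidiag r t

  det-bidiag : ∀ m → detℕ m bidiag ≈ x ^ m
  det-bidiag zero    = refl
  det-bidiag (suc m) = begin
    detℕ (suc m) bidiag
      ≈⟨ laplace m bidiag ⟩
    cofactorTerm m bidiag 0 + ∑ m (λ j → cofactorTerm m bidiag (suc j))
      ≈⟨ +-cong (trans (*-identityˡ _) (*-cong refl (det-bidiag m))) (∑-zero m offDiagonal) ⟩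
    x ^ suc m + 0#
      ≈⟨ +-identityʳ _ ⟩
    x ^ suc m ∎
    where
    -- the −1 entry meets a minor whose first column vanishes
    offDiagonal : ∀ j → j < m → cofactorTerm m bidiag (suc j) ≈ 0#
    offDiagonal zero    0<m = cofactor-zeroMinor m bidiag 1 (det-zeroColumn m (minor 1 bidiag) 0 0<m λ _ → refl)
    offDiagonal (suc j) _   = cofactor-zeroEntry m bidiag (suc (suc j)) refl

  [_] : Bool → C
  [ true  ] = 1#
  [ false ] = 0#

  δ : ℕ → ℕ → C
  δ a b = [ does (a ≟ b) ]

  x0-minus : ∀ y → x * 0# - y ≈ - y
  x0-minus y = trans (+-cong (zeroʳ x) refl) (+-identityˡ _)

  bidiag-entries : ∀ r t → x * δ r t - δ t (suc r) ≈ bidiag r t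
  bidiag-entries zero    zero          = trans (+-cong (*-identityʳ x) -0#≈0#) (+-identityʳ x)
  bidiag-entries zero    (suc zero)    = x0-minus 1#
  bidiag-entries zero    (suc (suc t)) = trans (x0-minus 0#) -0#≈0#
  bidiag-entries (suc r) zero          = trans (x0-minus 0#) -0#≈0#
  bidiag-entries (suc r) (suc t)       = bidiag-entries r t

  bordered : (f c : ℕ → C) → Matrix
  bordered f c zero    t       = f t
  bordered f c (suc r) zero    = c (suc r)
  bordered f c (suc r) (suc t) = bidiag r t

  -- the minor of `bordered f c` at column j + 1 (it does not depend on f):
  -- the column c followed by xI − N with its column j deleted
  borderMinor : (c : ℕ → C) → ℕ → Matrix
  borderMinor c j r zero    = c (suc r)
  borderMinor c j r (suc s) = bidiag r (punchInℕ j s)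

  det-bordered : ∀ m f c →
    detℕ (suc m) (bordered f c) ≈
    f 0 * x ^ m + ∑ m (λ j → sgn R (suc j) * (f (suc j) * detℕ m (borderMinor c j)))
  det-bordered m f c = begin
    detℕ (suc m) (bordered f c)
      ≈⟨ laplace m (bordered f c) ⟩
    cofactorTerm m (bordered f c) 0 + ∑ m (λ j → cofactorTerm m (bordered f c) (suc j))
      ≈⟨ +-cong (trans (*-identityˡ _) (*-cong refl (det-bidiag m)))
                (∑-cong m λ j _ → *-cong refl (*-cong refl (detℕ-cong m λ r s _ _ → sameMinor j r s))) ⟩
    f 0 * x ^ m + ∑ m (λ j → sgn R (suc j) * (f (suc j) * detℕ m (borderMinor c j))) ∎
    where
    sameMinor : ∀ j r s → minor (suc j) (bordered f c) r s ≈ borderMinor c j r s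
    sameMinor j r zero    = refl
    sameMinor j r (suc s) = refl

  -- ∑_{r<m} c (r+1) x^(m-1-r), the determinant of the minor at column 1
  columnPolynomial : (c : ℕ → C) → ℕ → C
  columnPolynomial c zero    = 0#
  columnPolynomial c (suc m) = c 1 * x ^ m + columnPolynomial (λ r → c (suc r)) m

  -- expand along the first row (c 1, −1, 0, …): the −1 leaves the same kind of minor
  det-borderMinor-zero : ∀ m c → detℕ (suc m) (borderMinor c 0) ≈ columnPolynomial c (suc m)
  det-borderMinor-zero m c = begin
    detℕ (suc m) (borderMinor c 0)
      ≈⟨ laplace m (borderMinor c 0) ⟩
    cofactorTerm m (borderMinor c 0) 0 + ∑ m (λ j → cofactorTerm m (borderMinor c 0) (suc j))
      ≈⟨ +-cong (trans (*-identityˡ _) (*-cong refl (det-bidiag m))) (rest m) ⟩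
    c 1 * x ^ m + columnPolynomial (λ r → c (suc r)) m ∎
    where
    rest : ∀ m → ∑ m (λ j → cofactorTerm m (borderMinor c 0) (suc j)) ≈ columnPolynomial (λ r → c (suc r)) m
    rest zero    = refl
    rest (suc m) = begin
      cofactorTerm (suc m) (borderMinor c 0) 1 + ∑ m (λ j → cofactorTerm (suc m) (borderMinor c 0) (suc (suc j)))
        ≈⟨ +-cong minusOne (∑-zero m λ j _ → cofactor-zeroEntry (suc m) (borderMinor c 0) (suc (suc j)) refl) ⟩
      detℕ (suc m) (borderMinor (λ r → c (suc r)) 0) + 0#
        ≈⟨ trans (+-identityʳ _) (det-borderMinor-zero m (λ r → c (suc r))) ⟩
      columnPolynomial (λ r → c (suc r)) (suc m) ∎
      where
      sameMinor : ∀ r s → minor 1 (borderMinor c 0) r s ≈ borderMinor (λ r → c (suc r)) 0 r s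
      sameMinor r zero    = refl
      sameMinor r (suc s) = refl
      minusOne : cofactorTerm (suc m) (borderMinor c 0) 1 ≈ detℕ (suc m) (borderMinor (λ r → c (suc r)) 0)
      minusOne = begin
        - 1# * (- 1# * detℕ (suc m) (minor 1 (borderMinor c 0)))
          ≈⟨ trans (-1*x≈-x _) (-‿cong (-1*x≈-x _)) ⟩
        - - detℕ (suc m) (minor 1 (borderMinor c 0))
          ≈⟨ -‿involutive _ ⟩
        detℕ (suc m) (minor 1 (borderMinor c 0))
          ≈⟨ detℕ-cong (suc m) (λ r s _ _ → sameMinor r s) ⟩
        detℕ (suc m) (borderMinor (λ r → c (suc r)) 0) ∎

  -- expand along the first row (c 1, x, −1 or 0, 0, …): only the x survives,
  -- since deleting column 0 or any column ≥ 2 leaves a zero column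
  det-borderMinor-suc : ∀ m c j →
    detℕ (suc (suc m)) (borderMinor c (suc j)) ≈ - x * detℕ (suc m) (borderMinor (λ r → c (suc r)) j)
  det-borderMinor-suc m c j = begin
    detℕ (suc (suc m)) M
      ≈⟨ laplace (suc m) M ⟩
    cofactorTerm (suc m) M 0 + (cofactorTerm (suc m) M 1 + ∑ m (λ u → cofactorTerm (suc m) M (suc (suc u))))
      ≈⟨ +-cong firstColumn (+-cong diagonal (∑-zero m laterColumns)) ⟩
    0# + (- x * detℕ (suc m) (borderMinor (λ r → c (suc r)) j) + 0#)
      ≈⟨ trans (+-identityˡ _) (+-identityʳ _) ⟩
    - x * detℕ (suc m) (borderMinor (λ r → c (suc r)) j) ∎
    where
    M = borderMinor c (suc j)
    firstColumn : cofactorTerm (suc m) M 0 ≈ 0#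
    firstColumn = cofactor-zeroMinor (suc m) M 0 (det-zeroColumn (suc m) (minor 0 M) 0 (s≤s z≤n) λ _ → refl)
    laterColumns : ∀ u → u < m → cofactorTerm (suc m) M (suc (suc u)) ≈ 0#
    laterColumns u (s≤s _) =
      cofactor-zeroMinor (suc m) M (suc (suc u))
        (det-zeroColumn (suc m) (minor (suc (suc u)) M) 1 (s≤s (s≤s z≤n)) λ _ → refl)
    sameMinor : ∀ r s → minor 1 M r s ≈ borderMinor (λ r → c (suc r)) j r s
    sameMinor r zero    = refl
    sameMinor r (suc s) = refl
    diagonal : cofactorTerm (suc m) M 1 ≈ - x * detℕ (suc m) (borderMinor (λ r → c (suc r)) j)
    diagonal = begin
      - 1# * (x * detℕ (suc m) (minor 1 M))
        ≈⟨ -1*x≈-x _ ⟩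
      - (x * detℕ (suc m) (minor 1 M))
        ≈⟨ -‿distribˡ-* x _ ⟩
      - x * detℕ (suc m) (minor 1 M)
        ≈⟨ *-cong refl (detℕ-cong (suc m) λ r s _ _ → sameMinor r s) ⟩
      - x * detℕ (suc m) (borderMinor (λ r → c (suc r)) j) ∎

  det-borderMinor-suc² : ∀ m c j → j < m →
    detℕ (suc (suc m)) (borderMinor c (suc (suc j))) ≈ (x * x) * detℕ m (borderMinor (λ r → c (suc (suc r))) j)
  det-borderMinor-suc² (suc m) c j _ = begin
    detℕ (suc (suc (suc m))) (borderMinor c (suc (suc j)))
      ≈⟨ det-borderMinor-suc (suc m) c (suc j) ⟩
    - x * detℕ (suc (suc m)) (borderMinor (λ r → c (suc r)) (suc j))
      ≈⟨ *-cong refl (det-borderMinor-suc m (λ r → c (suc r)) j) ⟩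
    - x * (- x * detℕ (suc m) (borderMinor (λ r → c (suc (suc r))) j))
      ≈⟨ sym (*-assoc _ _ _) ⟩
    (- x * - x) * detℕ (suc m) (borderMinor (λ r → c (suc (suc r))) j)
      ≈⟨ *-cong -x*-x≈x*x refl ⟩
    (x * x) * detℕ (suc m) (borderMinor (λ r → c (suc (suc r))) j) ∎
    where
    -x*-x≈x*x : - x * - x ≈ x * x
    -x*-x≈x*x = trans (sym (-‿distribˡ-* x (- x))) (trans (-‿cong (sym (-‿distribʳ-* x x))) (-‿involutive _))

-- Vertices are written 1-based (a+1, b+1)
-- so that (a, b) is the matrix position; the three arc families are
-- counted separately, each by locating the unique parameter (if any)
-- producing the given arc.
module ADFArcs where
  open import Data.Nat using (_≤_; s<s⁻¹; _+_; _*_; _∸_)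
  open import Data.Nat.Properties
    using (+-comm; *-cancelˡ-≡; *-distribˡ-+; +-identityʳ; ∸-monoˡ-<; *-cancelˡ-<; ≤-trans; n≤1+n)
  open import Data.List using (_++_; length; filter; applyUpTo)
  open import Data.List.Properties using (filter-++; length-++; filter-none; filter-accept; filter-reject)
  open import Data.List.Relation.Unary.All.Properties using (applyUpTo⁺₁)
  open import Data.Product using (proj₁; proj₂)
  open import Data.Product.Properties using (≡-dec; ,-injectiveˡ; ,-injectiveʳ)
  open import Relation.Nullary using (Dec; does)
  open import Relation.Nullary.Decidable using (dec-true; dec-false)

  bit : Bool → ℕ
  bit true  = 1
  bit false = 0

  isArc : ∀ i j (a : ℕ × ℕ) → Dec (a ≡ (i , j))
  isArc i j a = ≡-dec _≟_ _≟_ a (i , j)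

  arcCount-++ : ∀ xs ys i j → arcCount (xs ++ ys) i j ≡ arcCount xs i j + arcCount ys i j
  arcCount-++ xs ys i j = ≡.trans (≡.cong length (filter-++ (isArc i j) xs ys)) (length-++ (filter (isArc i j) xs))

  arcCount-absent : ∀ (g : ℕ → ℕ × ℕ) N i j → (∀ m → m < N → g m ≢ (i , j)) →
                    arcCount (applyUpTo g N) i j ≡ 0
  arcCount-absent g N i j missed = ≡.cong length (filter-none (isArc i j) (applyUpTo⁺₁ g N (missed _)))

  arcCount-unique : ∀ (g : ℕ → ℕ × ℕ) N c i j → c < N → g c ≡ (i , j) →
                    (∀ m → g m ≡ (i , j) → m ≡ c) → arcCount (applyUpTo g N) i j ≡ 1
  arcCount-unique g (suc N) zero    i j _         hit only =
    ≡.trans (≡.cong length (filter-accept (isArc i j) hit))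
            (≡.cong suc (arcCount-absent (λ m → g (suc m)) N i j λ m _ hit′ →
               contradiction (only (suc m) hit′) λ ()))
  arcCount-unique g (suc N) (suc c) i j (s≤s c<N) hit only =
    ≡.trans (≡.cong length (filter-reject (isArc i j) λ hit₀ → contradiction (only 0 hit₀) λ ()))
            (arcCount-unique (λ m → g (suc m)) N c i j c<N hit λ m hit′ → suc-injective (only (suc m) hit′))

  even : ℕ → Bool
  even zero          = true
  even (suc zero)    = false
  even (suc (suc n)) = even n

  data Half : ℕ → Set where
    twice     : ∀ h → Half (2 * h)
    twicePlus : ∀ h → Half (suc (2 * h))

  half : ∀ n → Half n
  half zero          = twice 0
  half (suc zero)    = twicePlus 0
  half (suc (suc n)) with half n
  ... | twice h     = ≡.subst Half (*-suc 2 h) (twice (suc h))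
  ... | twicePlus h = ≡.subst (λ m → Half (suc m)) (*-suc 2 h) (twicePlus (suc h))

  even-twice : ∀ h → even (2 * h) ≡ true
  even-twice zero    = ≡.refl
  even-twice (suc h) = ≡.trans (≡.cong even (*-suc 2 h)) (even-twice h)

  even-twicePlus : ∀ h → even (suc (2 * h)) ≡ false
  even-twicePlus zero    = ≡.refl
  even-twicePlus (suc h) = ≡.trans (≡.cong (λ m → even (suc m)) (*-suc 2 h)) (even-twicePlus h)

  twice≢twicePlus : ∀ m h → 2 * m ≢ suc (2 * h)
  twice≢twicePlus m h eq =
    contradiction (≡.trans (≡.sym (even-twice m)) (≡.trans (≡.cong even eq) (even-twicePlus h))) λ ()

  twice-suc : ∀ m → 2 * (m + 1) ≡ suc (suc (2 * m))
  twice-suc m = ≡.trans (*-distribˡ-+ 2 m 1) (+-comm (2 * m) 2)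

  twice-suc+1 : ∀ m → 2 * (m + 1) + 1 ≡ suc (suc (suc (2 * m)))
  twice-suc+1 m = ≡.trans (+-comm (2 * (m + 1)) 1) (≡.cong suc (twice-suc m))

  pathArc-at outArc-at inArc-at : ℕ → ℕ × ℕ
  pathArc-at m = (m + 2 , m + 3)
  outArc-at  m = (1 , 2 * (m + 1))
  inArc-at   m = (2 * (m + 1) + 1 , 1)

  pathLength : ℕ → ℕ
  pathLength k = 2 * k + 1 ∸ 2

  path-inv : ∀ m {a b} → pathArc-at m ≡ (suc a , suc b) → a ≡ suc m × b ≡ suc (suc m)
  path-inv m eq = suc-injective (≡.trans (≡.sym (,-injectiveˡ eq)) (+-comm m 2))
                , suc-injective (≡.trans (≡.sym (,-injectiveʳ eq)) (+-comm m 3))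

  out-inv : ∀ m {a b} → outArc-at m ≡ (suc a , suc b) → a ≡ 0 × b ≡ suc (2 * m)
  out-inv m eq = ≡.sym (suc-injective (,-injectiveˡ eq))
               , suc-injective (≡.trans (≡.sym (,-injectiveʳ eq)) (twice-suc m))

  in-inv : ∀ m {a b} → inArc-at m ≡ (suc a , suc b) → a ≡ suc (suc (2 * m)) × b ≡ 0
  in-inv m eq = suc-injective (≡.trans (≡.sym (,-injectiveˡ eq)) (twice-suc+1 m))
              , ≡.sym (suc-injective (,-injectiveʳ eq))

  half-bound : ∀ h k → suc (2 * h) < 2 * k + 1 → h < k
  half-bound h k bound = *-cancelˡ-< 2 h k (s<s⁻¹ (≡.subst (suc (2 * h) <_) (+-comm (2 * k) 1) bound))

  pathArc outArc inArc : ℕ → ℕ → Bool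
  pathArc (suc r) (suc b) = does (b ≟ suc r)                  -- t → t+1 for t ≥ 2
  pathArc _       _       = false
  outArc  zero    (suc b) = even b                             -- 1 → 2i
  outArc  _       _       = false
  inArc   (suc r) zero    = even (suc r)                       -- 2i+1 → 1
  inArc   _       _       = false

  pathArcs-count : ∀ k a b → b < 2 * k + 1 →
                   arcCount (applyUpTo pathArc-at (pathLength k)) (suc a) (suc b) ≡ bit (pathArc a b)
  pathArcs-count k zero b _ =
    arcCount-absent pathArc-at (pathLength k) 1 (suc b) λ m _ hit → contradiction (proj₁ (path-inv m hit)) λ ()
  pathArcs-count k (suc r) zero _ =
    arcCount-absent pathArc-at (pathLength k) (suc (suc r)) 1 λ m _ hit → contradiction (proj₂ (path-inv m hit)) λ ()
  pathArcs-count k (suc r) (suc b) b<n with b ≟ suc r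
  ... | yes ≡.refl = ≡.trans
    (arcCount-unique pathArc-at (pathLength k) r (suc (suc r)) (suc (suc (suc r))) (∸-monoˡ-< b<n (s≤s (s≤s z≤n)))
       (≡.cong₂ _,_ (+-comm r 2) (+-comm r 3))
       λ m hit → suc-injective (≡.sym (proj₁ (path-inv m hit))))
    (≡.cong bit (≡.sym (dec-true (b ≟ suc r) ≡.refl)))
  ... | no b≢r+1 = ≡.trans
    (arcCount-absent pathArc-at (pathLength k) (suc (suc r)) (suc (suc b)) λ m _ hit →
       let a≡ , b≡ = path-inv m hit in b≢r+1 (≡.trans (suc-injective b≡) (≡.sym a≡)))
    (≡.cong bit (≡.sym (dec-false (b ≟ suc r) b≢r+1)))

  outArcs-count : ∀ k a b → b < 2 * k + 1 →
                  arcCount (applyUpTo outArc-at k) (suc a) (suc b) ≡ bit (outArc a b)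
  outArcs-count k (suc r) b _ =
    arcCount-absent outArc-at k (suc (suc r)) (suc b) λ m _ hit → contradiction (proj₁ (out-inv m hit)) λ ()
  outArcs-count k zero zero _ =
    arcCount-absent outArc-at k 1 1 λ m _ hit → contradiction (proj₂ (out-inv m hit)) λ ()
  outArcs-count k zero (suc b) b<n with half b
  ... | twice h rewrite even-twice h =
    arcCount-unique outArc-at k h 1 (suc (suc (2 * h))) (half-bound h k b<n) (≡.cong (1 ,_) (twice-suc h))
      λ m hit → *-cancelˡ-≡ m h 2 (suc-injective (≡.sym (proj₂ (out-inv m hit))))
  ... | twicePlus h rewrite even-twicePlus h =
    arcCount-absent outArc-at k 1 (suc (suc (suc (2 * h)))) λ m _ hit →
      twice≢twicePlus m h (≡.sym (suc-injective (proj₂ (out-inv m hit))))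

  inArcs-count : ∀ k a b → a < 2 * k + 1 →
                 arcCount (applyUpTo inArc-at k) (suc a) (suc b) ≡ bit (inArc a b)
  inArcs-count k zero b _ =
    arcCount-absent inArc-at k 1 (suc b) λ m _ hit → contradiction (proj₁ (in-inv m hit)) λ ()
  inArcs-count k (suc r) (suc b) _ =
    arcCount-absent inArc-at k (suc (suc r)) (suc (suc b)) λ m _ hit → contradiction (proj₂ (in-inv m hit)) λ ()
  inArcs-count k (suc r) zero a<n with half r
  ... | twice h rewrite even-twicePlus h =
    arcCount-absent inArc-at k (suc (suc (2 * h))) 1 λ m _ hit →
      twice≢twicePlus h m (suc-injective (proj₁ (in-inv m hit)))
  ... | twicePlus h rewrite even-twice h =
    arcCount-unique inArc-at k h (suc (suc (suc (2 * h)))) 1 (half-bound h k (≤-trans (n≤1+n _) a<n))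
      (≡.cong (_, 1) (twice-suc+1 h))
      λ m hit → *-cancelˡ-≡ m h 2 (suc-injective (suc-injective (≡.sym (proj₁ (in-inv m hit)))))

  adfArc : ℕ → ℕ → Bool
  adfArc zero    zero    = false
  adfArc zero    (suc b) = even b
  adfArc (suc r) zero    = even (suc r)
  adfArc (suc r) (suc b) = does (b ≟ suc r)

  families-disjoint : ∀ a b → bit (pathArc a b) + (bit (outArc a b) + bit (inArc a b)) ≡ bit (adfArc a b)
  families-disjoint zero    zero    = ≡.refl
  families-disjoint zero    (suc b) = +-identityʳ (bit (even b))
  families-disjoint (suc r) zero    = ≡.refl
  families-disjoint (suc r) (suc b) = +-identityʳ (bit (does (b ≟ suc r)))

  arcCount-ADF : ∀ k a b → a < 2 * k + 1 → b < 2 * k + 1 →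
                 arcCount (arcs (ADF k)) (suc a) (suc b) ≡ bit (adfArc a b)
  arcCount-ADF k a b a<n b<n = begin
    arcCount (paths ++ outs ++ ins) (suc a) (suc b)
      ≡⟨ arcCount-++ paths (outs ++ ins) (suc a) (suc b) ⟩
    arcCount paths (suc a) (suc b) + arcCount (outs ++ ins) (suc a) (suc b)
      ≡⟨ ≡.cong (arcCount paths (suc a) (suc b) +_) (arcCount-++ outs ins (suc a) (suc b)) ⟩
    arcCount paths (suc a) (suc b) + (arcCount outs (suc a) (suc b) + arcCount ins (suc a) (suc b))
      ≡⟨ ≡.cong₂ _+_ (pathArcs-count k a b b<n)
                     (≡.cong₂ _+_ (outArcs-count k a b b<n) (inArcs-count k a b a<n)) ⟩
    bit (pathArc a b) + (bit (outArc a b) + bit (inArc a b))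
      ≡⟨ families-disjoint a b ⟩
    bit (adfArc a b) ∎
    where
    open ≡.≡-Reasoning
    paths = applyUpTo pathArc-at (pathLength k)
    outs  = applyUpTo outArc-at k
    ins   = applyUpTo inArc-at k

module ADFDeterminant {c ℓ : Level} (R : CommutativeRing c ℓ) (x : CommutativeRing.Carrier R) where
  open CommutativeRing R hiding (zero) renaming (Carrier to C)
  open import Algebra.Properties.Ring ring using (-1*x≈-x; -‿distribʳ-*; -‿involutive; -0#≈0#; -‿+-comm)
  open import Algebra.Properties.Semiring.Exp semiring using (_^_)
  open import Algebra.Properties.Semiring.Mult semiring using (×-comm-*; ×-congʳ)
  open import Algebra.Properties.CommutativeSemigroup *-commutativeSemigroup using (x∙yz≈y∙xz)
  open import Algebra.Properties.CommutativeSemigroup +-commutativeSemigroup using (interchange)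
  open import Relation.Binary.Reasoning.Setoid setoid
  open Determinant R
  open BorderedBidiagonal R x
  open ADFArcs using (even; bit; adfArc; arcCount-ADF)
  open import Relation.Nullary using (does)
  open import Relation.Nullary.Decidable using (dec-true; dec-false)
  import Data.Nat.Properties as ℕₚ

  negEven : ℕ → C
  negEven r = - [ even r ]

  adfTop : ℕ → C
  adfTop zero    = x
  adfTop (suc j) = negEven j

  identity-δ : ∀ n (i j : Fin n) → identity R n i j ≈ δ (toℕ i) (toℕ j)
  identity-δ n i j with toℕ i ≟ toℕ j
  ... | yes i≡j = reflexive (≡.sym (≡.cong [_] (dec-true (toℕ i ≟ toℕ j) i≡j)))
  ... | no  i≢j = reflexive (≡.sym (≡.cong [_] (dec-false (toℕ i ≟ toℕ j) i≢j)))

  bit-as-indicator : ∀ β → _·ℕ_ R (bit β) 1# ≈ [ β ]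
  bit-as-indicator true  = +-identityʳ 1#
  bit-as-indicator false = refl

  adf-entries : ∀ a b → x * δ a b - [ adfArc a b ] ≈ bordered adfTop negEven a b
  adf-entries zero    zero    = trans (+-cong (*-identityʳ x) -0#≈0#) (+-identityʳ x)
  adf-entries zero    (suc b) = x0-minus _
  adf-entries (suc r) zero    = x0-minus _
  adf-entries (suc r) (suc b) = bidiag-entries r b

  charMatrix-ADF : ∀ k → charPoly R (ADF k) x ≈ detℕ (2 ℕ.* k ℕ.+ 1) (bordered adfTop negEven)
  charMatrix-ADF k = det-cong n λ i j → begin
    x * identity R n i j - _·ℕ_ R (arcCount (arcs (ADF k)) (suc (toℕ i)) (suc (toℕ j))) 1#
      ≈⟨ +-cong (*-cong refl (identity-δ n i j))
                (-‿cong (trans (reflexive (≡.cong (λ m → _·ℕ_ R m 1#)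
                                  (arcCount-ADF k (toℕ i) (toℕ j) (toℕ<n i) (toℕ<n j))))
                               (bit-as-indicator (adfArc (toℕ i) (toℕ j))))) ⟩
    x * δ (toℕ i) (toℕ j) - [ adfArc (toℕ i) (toℕ j) ]
      ≈⟨ adf-entries (toℕ i) (toℕ j) ⟩
    bordered adfTop negEven (toℕ i) (toℕ j) ∎
    where n = 2 ℕ.* k ℕ.+ 1

  -- the Laplace terms of bordered adfTop negEven beyond the diagonal one
  tailSum : ℕ → C
  tailSum m = ∑ m (λ j → sgn R (suc j) * (negEven j * detℕ m (borderMinor negEven j)))

  det-adfBordered : ∀ m → detℕ (suc m) (bordered adfTop negEven) ≈ x ^ suc m + tailSum m
  det-adfBordered m = det-bordered m adfTop negEven

  evenPowers : ℕ → C
  evenPowers zero    = 0#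
  evenPowers (suc k) = evenPowers k + x ^ (2 ℕ.* k)

  -- negEven vanishes at 1 and is −1 at 2, and is 2-periodic
  columnPolynomial-step : ∀ m → columnPolynomial negEven (suc (suc m)) ≈ - x ^ m + columnPolynomial negEven m
  columnPolynomial-step m = begin
    - 0# * x ^ suc m + (- 1# * x ^ m + columnPolynomial negEven m)
      ≈⟨ +-cong (trans (*-cong -0#≈0# refl) (zeroˡ _)) (+-cong (-1*x≈-x _) refl) ⟩
    0# + (- x ^ m + columnPolynomial negEven m)
      ≈⟨ +-identityˡ _ ⟩
    - x ^ m + columnPolynomial negEven m ∎

  columnPolynomial-evenLength : ∀ k → columnPolynomial negEven (2 ℕ.* k) ≈ - evenPowers k
  columnPolynomial-evenLength zero    = sym -0#≈0#
  columnPolynomial-evenLength (suc k) = begin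
    columnPolynomial negEven (2 ℕ.* suc k)
      ≡⟨ ≡.cong (columnPolynomial negEven) (*-suc 2 k) ⟩
    columnPolynomial negEven (suc (suc (2 ℕ.* k)))
      ≈⟨ columnPolynomial-step (2 ℕ.* k) ⟩
    - x ^ (2 ℕ.* k) + columnPolynomial negEven (2 ℕ.* k)
      ≈⟨ +-cong refl (columnPolynomial-evenLength k) ⟩
    - x ^ (2 ℕ.* k) + - evenPowers k
      ≈⟨ trans (+-comm _ _) (-‿+-comm _ _) ⟩
    - evenPowers (suc k) ∎

  -- peeling two columns: the first gives the column polynomial, the second
  -- vanishes, and the rest are x² times the terms of the smaller matrix
  tailSum-step : ∀ m → tailSum (suc (suc m)) ≈ columnPolynomial negEven (suc (suc m)) + (x * x) * tailSum m
  tailSum-step m = begin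
    term 0 + (term 1 + ∑ m (λ u → term (suc (suc u))))
      ≈⟨ +-cong first (+-cong second (∑-cong m later)) ⟩
    columnPolynomial negEven (suc (suc m)) + (0# + ∑ m (λ u → (x * x) * smallTerm u))
      ≈⟨ +-cong refl (trans (+-identityˡ _) (sym (*-distribˡ-∑ m (x * x) smallTerm))) ⟩
    columnPolynomial negEven (suc (suc m)) + (x * x) * tailSum m ∎
    where
    term smallTerm : ℕ → C
    term j      = sgn R (suc j) * (negEven j * detℕ (suc (suc m)) (borderMinor negEven j))
    smallTerm j = sgn R (suc j) * (negEven j * detℕ m (borderMinor negEven j))
    first : term 0 ≈ columnPolynomial negEven (suc (suc m))
    first = begin
      - 1# * (- 1# * detℕ (suc (suc m)) (borderMinor negEven 0))
        ≈⟨ trans (-1*x≈-x _) (-‿cong (-1*x≈-x _)) ⟩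
      - - detℕ (suc (suc m)) (borderMinor negEven 0)
        ≈⟨ -‿involutive _ ⟩
      detℕ (suc (suc m)) (borderMinor negEven 0)
        ≈⟨ det-borderMinor-zero (suc m) negEven ⟩
      columnPolynomial negEven (suc (suc m)) ∎
    second : term 1 ≈ 0#
    second = trans (*-cong refl (trans (*-cong -0#≈0# refl) (zeroˡ _))) (zeroʳ _)
    later : ∀ u → u < m → term (suc (suc u)) ≈ (x * x) * smallTerm u
    later u u<m = begin
      - - sgn R (suc u) * (negEven u * detℕ (suc (suc m)) (borderMinor negEven (suc (suc u))))
        ≈⟨ *-cong (-‿involutive _) (*-cong refl (det-borderMinor-suc² m negEven u u<m)) ⟩
      sgn R (suc u) * (negEven u * ((x * x) * detℕ m (borderMinor negEven u)))
        ≈⟨ trans (*-cong refl (x∙yz≈y∙xz _ _ _)) (x∙yz≈y∙xz _ _ _) ⟩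
      (x * x) * smallTerm u ∎

  rhsSum-step : ∀ k → rhsSum R (suc k) x ≈ evenPowers (suc k) + (x * x) * rhsSum R k x
  rhsSum-step zero = trans (+-cong refl (+-identityʳ _)) (sym (trans (+-cong refl (zeroʳ _)) (+-identityʳ _)))
  rhsSum-step (suc k) = begin
    rhsSum R (suc k) x + (suc (suc k) · x^2k+2)
      ≈⟨ +-cong (rhsSum-step k) refl ⟩
    (evenPowers (suc k) + (x * x) * rhsSum R k x) + (x^2k+2 + suc k · x^2k+2)
      ≈⟨ interchange _ _ _ _ ⟩
    evenPowers (suc (suc k)) + ((x * x) * rhsSum R k x + suc k · x^2k+2)
      ≈⟨ +-cong refl (+-cong refl (×-congʳ (suc k) (sym x²·x^2k))) ⟩
    evenPowers (suc (suc k)) + ((x * x) * rhsSum R k x + suc k · ((x * x) * x ^ (2 ℕ.* k)))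
      ≈⟨ +-cong refl (+-cong refl (sym (×-comm-* (suc k) (x * x) _))) ⟩
    evenPowers (suc (suc k)) + ((x * x) * rhsSum R k x + (x * x) * (suc k · (x ^ (2 ℕ.* k))))
      ≈⟨ +-cong refl (sym (distribˡ _ _ _)) ⟩
    evenPowers (suc (suc k)) + (x * x) * rhsSum R (suc k) x ∎
    where
    _·_ = _·ℕ_ R
    x^2k+2 = x ^ (2 ℕ.* suc k)
    x²·x^2k : (x * x) * x ^ (2 ℕ.* k) ≈ x^2k+2
    x²·x^2k = trans (*-assoc x x _) (reflexive (≡.cong (x ^_) (≡.sym (*-suc 2 k))))

  tailSum-closed : ∀ k → tailSum (2 ℕ.* k) ≈ - rhsSum R k x
  tailSum-closed zero    = sym -0#≈0#
  tailSum-closed (suc k) = begin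
    tailSum (2 ℕ.* suc k)
      ≡⟨ ≡.cong tailSum (*-suc 2 k) ⟩
    tailSum (suc (suc (2 ℕ.* k)))
      ≈⟨ tailSum-step (2 ℕ.* k) ⟩
    columnPolynomial negEven (suc (suc (2 ℕ.* k))) + (x * x) * tailSum (2 ℕ.* k)
      ≡⟨ ≡.cong (λ m → columnPolynomial negEven m + (x * x) * tailSum (2 ℕ.* k)) (≡.sym (*-suc 2 k)) ⟩
    columnPolynomial negEven (2 ℕ.* suc k) + (x * x) * tailSum (2 ℕ.* k)
      ≈⟨ +-cong (columnPolynomial-evenLength (suc k)) (*-cong refl (tailSum-closed k)) ⟩
    - evenPowers (suc k) + (x * x) * - rhsSum R k x
      ≈⟨ +-cong refl (sym (-‿distribʳ-* _ _)) ⟩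
    - evenPowers (suc k) + - ((x * x) * rhsSum R k x)
      ≈⟨ -‿+-comm _ _ ⟩
    - (evenPowers (suc k) + (x * x) * rhsSum R k x)
      ≈⟨ -‿cong (sym (rhsSum-step k)) ⟩
    - rhsSum R (suc k) x ∎

  charPoly-ADF : ∀ k → charPoly R (ADF k) x ≈ x ^ (2 ℕ.* k ℕ.+ 1) - rhsSum R k x
  charPoly-ADF k = begin
    charPoly R (ADF k) x
      ≈⟨ charMatrix-ADF k ⟩
    detℕ (2 ℕ.* k ℕ.+ 1) (bordered adfTop negEven)
      ≡⟨ ≡.cong (λ n → detℕ n (bordered adfTop negEven)) order≡ ⟩
    detℕ (suc (2 ℕ.* k)) (bordered adfTop negEven)
      ≈⟨ det-adfBordered (2 ℕ.* k) ⟩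
    x ^ suc (2 ℕ.* k) + tailSum (2 ℕ.* k)
      ≈⟨ +-cong refl (tailSum-closed k) ⟩
    x ^ suc (2 ℕ.* k) - rhsSum R k x
      ≡⟨ ≡.cong (λ n → x ^ n - rhsSum R k x) (≡.sym order≡) ⟩
    x ^ (2 ℕ.* k ℕ.+ 1) - rhsSum R k x ∎
    where
    order≡ : 2 ℕ.* k ℕ.+ 1 ≡ suc (2 ℕ.* k)
    order≡ = ℕₚ.+-comm (2 ℕ.* k) 1

open Defs using (_^_)
open import Data.Nat using (_≤_; _+_; _*_)

-- The identity holds for every k (for k = 0 it reads Ψ = x), so 1 ≤ k is unused.

mainTheorem4 : {c ℓ : Level} (R : CommutativeRing c ℓ) (k : ℕ) → 1 ≤ k →
    (x : CommutativeRing.Carrier R) →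
    CommutativeRing._≈_ R (charPoly R (ADF k) x)
    (CommutativeRing._-_ R (_^_ R x (2 * k + 1)) (rhsSum R k x))
mainTheorem4 R k _ x = ADFDeterminant.charPoly-ADF R x k
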